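{- Let $\Delta$ be a flag weak $3$-pseudomanifold on $n$ vertices, and let $\sigma=\{v_1,v_2,v_3,v_4\}$ be any facet of $\Delta$. Then $\sum_{i=1}^4 f_0(\mathrm{lk}_\Delta v_i)\leq 2n+8$. If equality holds, then $\bigcup_{w\in\tau}V(\mathrm{lk}_\Delta w)=V(\Delta)$ for every ridge (2-face) $\tau\subseteq\sigma$.
   Context: A simplicial complex is flag if every minimal non-face has exactly two elements. A weak $3$-pseudomanifold is a pure $3$-dimensional simplicial complex in which every $2$-face lies in exactly two facets. For a face $\tau$, $\mathrm{lk}_\Delta\tau=\{\rho-\tau:\tau\subseteq\rho\in\Delta\}$; $V(\cdot)$ is the vertex set and $f_0(\cdot)$ the number of vertices. -}

module Defs where

open import Data.Nat using (ℕ; _+_)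
open import Data.Fin using (Fin)
open import Data.Fin.Subset using (Subset; _∈_; _∉_; _⊆_; _⊂_; _─_; ⁅_⁆; ∣_∣)
open import Data.Fin.Subset.Properties using (_∈?_)
open import Data.List using (List; map; allFin)
open import Data.Nat.ListAction using (sum)
open import Data.Product using (Σ; ∃; _×_)
open import Data.Sum using (_⊎_)
open import Relation.Nullary using (¬_; Dec; yes; no)
open import Relation.Binary.PropositionalEquality using (_≡_)

-- A (finite, abstract) simplicial complex whose vertex set is exactly Fin n:
-- faces are subsets of Fin n given by a decidable predicate, closed under
-- taking subsets, and every singleton {v} is a face (so V(Δ) = Fin n and Δ has n vertices).
record SimplicialComplex (n : ℕ) : Set₁ where
  field
    Face       : Subset n → Set
    face?      : (σ : Subset n) → Dec (Face σ)
    down-closed : ∀ {σ τ} → Face σ → τ ⊆ σ → Face τ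
    vertex     : ∀ (v : Fin n) → Face ⁅ v ⁆
open SimplicialComplex public

module _ {n : ℕ} (Δ : SimplicialComplex n) where

  IsFacet : Subset n → Set
  IsFacet σ = Face Δ σ × (∀ ρ → Face Δ ρ → σ ⊆ ρ → ρ ≡ σ)

  IsMinimalNonFace : Subset n → Set
  IsMinimalNonFace σ = ¬ Face Δ σ × (∀ τ → τ ⊂ σ → Face Δ τ)

  IsFlag : Set
  IsFlag = ∀ σ → IsMinimalNonFace σ → ∣ σ ∣ ≡ 2

  IsPure3 : Set
  IsPure3 = ∀ σ → IsFacet σ → ∣ σ ∣ ≡ 4

  InExactlyTwoFacets : Subset n → Set
  InExactlyTwoFacets τ =
    Σ (Subset n) λ ρ₁ → Σ (Subset n) λ ρ₂ →
      IsFacet ρ₁ × IsFacet ρ₂ × ¬ (ρ₁ ≡ ρ₂) × τ ⊆ ρ₁ × τ ⊆ ρ₂ ×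
      (∀ ρ → IsFacet ρ → τ ⊆ ρ → (ρ ≡ ρ₁ ⊎ ρ ≡ ρ₂))

  IsWeak3Pseudomanifold : Set
  IsWeak3Pseudomanifold =
    IsPure3 × (∀ τ → Face Δ τ → ∣ τ ∣ ≡ 3 → InExactlyTwoFacets τ)

  LinkFace : Subset n → Subset n → Set
  LinkFace τ α = Σ (Subset n) λ ρ → Face Δ ρ × τ ⊆ ρ × α ≡ ρ ─ τ

  LinkVertex : Subset n → Fin n → Set
  LinkVertex τ u = LinkFace τ ⁅ u ⁆

  IsLinkVertexSet : Subset n → Subset n → Set
  IsLinkVertexSet τ W = ∀ u → (u ∈ W → LinkVertex τ u) × (LinkVertex τ u → u ∈ W)

sumOver : {n : ℕ} → Subset n → (Fin n → ℕ) → ℕ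
sumOver {n} σ f = sum (map g (allFin n))
  where
  g : Fin n → ℕ
  g u with u ∈? σ
  ... | yes _ = f u
  ... | no  _ = 0

module Submission where

-- For a
-- vertex u of Δ let hits u be the number of v ∈ σ with u ∈ lk v and misses u
-- the number of v ∈ σ with u ∉ lk v, so hits u + misses u = 4.  Double
-- counting gives  Σ_{v∈σ} f₀(lk v) = Σ_u hits u.  Every u misses some vertex
-- of σ: a vertex of σ misses itself, and a vertex u ∉ σ missing nothing would
-- make σ ∪ {u} a clique, hence (flagness) a face strictly containing σ.  If
-- u ∉ σ misses exactly one v ∈ σ, call u opposite to v; then (σ − v) ∪ {u} is
-- a face, and since the ridge σ − v lies in only two facets, v has at most one
-- opposite vertex.  Hence hits u ≤ 2 + [u ∈ σ] + #{v : u opposite to v},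
-- and summing gives  Σ_u hits u ≤ 2n + 4 + 4.  At equality every one of these
-- pointwise bounds is attained, so hits u ≥ 2 for every u; a vertex missing
-- all three vertices of a ridge τ ⊆ σ would have hits u ≤ 1.

open import Defs
open import Data.Nat using (ℕ; zero; suc; _+_; _*_; _∸_; _≤_; _<_; z≤n; s≤s; s≤s⁻¹)
open import Data.Nat.Properties
open import Data.Fin using (Fin; zero; suc)
open import Data.Fin.Properties using (any?) renaming (_≟_ to _≟ᶠ_; suc-injective to suc-injectiveᶠ)
open import Data.Fin.Subset using (Subset; _∈_; _∉_; _⊆_; _⊂_; _∪_; _─_; _-_; ⁅_⁆; ∣_∣; Nonempty; inside; outside)
open import Data.Fin.Subset.Properties
open import Data.Vec using (_∷_; []; here; there)
open import Data.List using (map; allFin; tabulate)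
open import Data.List.Properties using (map-tabulate)
import Data.Nat.ListAction as List
open import Algebra.Properties.Semiring.Sum +-*-semiring
  using (sum; sum-syntax; sum-cong-≗; ∑-distrib-+; ∑-comm; *-distribˡ-sum)
open import Data.Product using (Σ; ∃; _×_; _,_; proj₁; proj₂)
open import Data.Sum using (_⊎_; inj₁; inj₂)
open import Data.Empty using (⊥; ⊥-elim)
open import Function using (_∘_; id)
open import Relation.Nullary using (¬_; Dec; yes; no; contradiction)
open import Relation.Nullary.Decidable using (_×-dec_; ¬?; decidable-stable)
open import Relation.Binary.PropositionalEquality

∑-mono-≤ : ∀ {n} {f g : Fin n → ℕ} → (∀ i → f i ≤ g i) → sum f ≤ sum g
∑-mono-≤ {zero}  f≤g = z≤n
∑-mono-≤ {suc n} f≤g = +-mono-≤ (f≤g zero) (∑-mono-≤ (f≤g ∘ suc))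

∑-mono-< : ∀ {n} {f g : Fin n → ℕ} → (∀ i → f i ≤ g i) → ∀ i → f i < g i → sum f < sum g
∑-mono-< f≤g zero    fi<gi = +-mono-<-≤ fi<gi (∑-mono-≤ (f≤g ∘ suc))
∑-mono-< f≤g (suc i) fi<gi = +-mono-≤-< (f≤g zero) (∑-mono-< (f≤g ∘ suc) i fi<gi)

∑-tight : ∀ {n} {f g : Fin n → ℕ} → (∀ i → f i ≤ g i) → sum g ≤ sum f → ∀ i → g i ≤ f i
∑-tight f≤g Σg≤Σf i = ≮⇒≥ (λ fi<gi → <⇒≱ (∑-mono-< f≤g i fi<gi) Σg≤Σf)

∑-term : ∀ {n} (f : Fin n → ℕ) i → f i ≤ sum f
∑-term f zero    = m≤m+n (f zero) _
∑-term f (suc i) = ≤-trans (∑-term (f ∘ suc) i) (m≤n+m _ (f zero))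

∑-two : ∀ {n} (f : Fin n → ℕ) {i j} → i ≢ j → f i + f j ≤ sum f
∑-two f {zero}  {zero}  i≢j = contradiction refl i≢j
∑-two f {zero}  {suc j} i≢j = +-monoʳ-≤ (f zero) (∑-term (f ∘ suc) j)
∑-two f {suc i} {zero}  i≢j =
  subst (_≤ sum f) (+-comm (f zero) (f (suc i))) (+-monoʳ-≤ (f zero) (∑-term (f ∘ suc) i))
∑-two f {suc i} {suc j} i≢j =
  ≤-trans (∑-two (f ∘ suc) (i≢j ∘ cong suc)) (m≤n+m _ (f zero))

∑-const : ∀ n k → ∑[ i < n ] k ≡ n * k
∑-const zero    k = refl
∑-const (suc n) k = cong (k +_) (∑-const n k)

listSum-tabulate : ∀ {n} (f : Fin n → ℕ) → List.sum (tabulate f) ≡ sum f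
listSum-tabulate {zero}  f = refl
listSum-tabulate {suc n} f = cong (f zero +_) (listSum-tabulate (f ∘ suc))

listSum-allFin : ∀ {n} (f : Fin n → ℕ) → List.sum (map f (allFin n)) ≡ sum f
listSum-allFin f = trans (cong List.sum (map-tabulate id f)) (listSum-tabulate f)

χ : ∀ {P : Set} → Dec P → ℕ
χ (yes _) = 1
χ (no _)  = 0

χ-mono : ∀ {P Q : Set} → (P → Q) → (p : Dec P) (q : Dec Q) → χ p ≤ χ q
χ-mono P⇒Q (yes p) (yes _) = ≤-refl
χ-mono P⇒Q (yes p) (no ¬q) = contradiction (P⇒Q p) ¬q
χ-mono P⇒Q (no _)  _       = z≤n

χ-cong : ∀ {P Q : Set} → (P → Q) → (Q → P) → (p : Dec P) (q : Dec Q) → χ p ≡ χ q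
χ-cong P⇒Q Q⇒P p q = ≤-antisym (χ-mono P⇒Q p q) (χ-mono Q⇒P q p)

χ-true : ∀ {P : Set} (p : Dec P) → P → 1 ≤ χ p
χ-true (yes _) _  = ≤-refl
χ-true (no ¬p) p = contradiction p ¬p

χ-× : ∀ {P Q : Set} (p : Dec P) (q : Dec Q) → χ (p ×-dec q) ≡ χ p * χ q
χ-× (yes _) (yes _) = refl
χ-× (yes _) (no _)  = refl
χ-× (no _)  _       = refl

χ-split : ∀ {P Q : Set} (p : Dec P) (q : Dec Q) → χ (p ×-dec q) + χ (p ×-dec ¬? q) ≡ χ p
χ-split (yes _) (yes _) = refl
χ-split (yes _) (no _)  = refl
χ-split (no _)  _       = refl

count : ∀ {n} {P : Fin n → Set} → (∀ i → Dec (P i)) → ℕ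
count {n} P? = ∑[ i < n ] χ (P? i)

count-mono : ∀ {n} {P Q : Fin n → Set} (P? : ∀ i → Dec (P i)) (Q? : ∀ i → Dec (Q i)) →
  (∀ {i} → P i → Q i) → count P? ≤ count Q?
count-mono P? Q? P⇒Q = ∑-mono-≤ (λ i → χ-mono P⇒Q (P? i) (Q? i))

count-≥1 : ∀ {n} {P : Fin n → Set} (P? : ∀ i → Dec (P i)) {i} → P i → 1 ≤ count P?
count-≥1 P? {i} p = ≤-trans (χ-true (P? i) p) (∑-term (χ ∘ P?) i)

count-witness : ∀ {n} {P : Fin n → Set} (P? : ∀ i → Dec (P i)) → 1 ≤ count P? → ∃ P
count-witness {suc n} P? 1≤count with P? zero
... | yes p = zero , p
... | no _  = let (i , p) = count-witness (P? ∘ suc) 1≤count in suc i , p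

count-unique : ∀ {n} {P : Fin n → Set} (P? : ∀ i → Dec (P i)) →
  count P? ≤ 1 → ∀ {i j} → P i → P j → i ≡ j
count-unique P? count≤1 {i} {j} pi pj with i ≟ᶠ j
... | yes i≡j = i≡j
... | no i≢j  = contradiction
  (≤-trans (+-mono-≤ (χ-true (P? i) pi) (χ-true (P? j) pj)) (∑-two (χ ∘ P?) i≢j))
  (<⇒≱ (s≤s count≤1))

count-≤1 : ∀ {n} {P : Fin n → Set} (P? : ∀ i → Dec (P i)) →
  (∀ {i j} → P i → P j → i ≡ j) → count P? ≤ 1
count-≤1 {zero}  P? unique = z≤n
count-≤1 {suc n} P? unique with P? zero
... | yes p₀ = s≤s (≮⇒≥ λ 1≤rest →
  let (i , pᵢ) = count-witness (P? ∘ suc) 1≤rest in zero≢suc (unique p₀ pᵢ))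
  where
  zero≢suc : ∀ {i : Fin n} → zero ≢ suc i
  zero≢suc ()
... | no _ = count-≤1 (P? ∘ suc) (λ pi pj → suc-injectiveᶠ (unique pi pj))

count-≤-χ : ∀ {n} {P : Fin n → Set} {Q : Set} (P? : ∀ i → Dec (P i)) →
  (∀ {i} → P i → Q) → (∀ {i j} → P i → P j → i ≡ j) → (Q? : Dec Q) → count P? ≤ χ Q?
count-≤-χ P? P⇒Q unique (yes _) = count-≤1 P? unique
count-≤-χ P? P⇒Q unique (no ¬Q) = ≮⇒≥ λ 1≤count → ¬Q (P⇒Q (proj₂ (count-witness P? 1≤count)))

count-split : ∀ {n} {P Q : Fin n → Set} (P? : ∀ i → Dec (P i)) (Q? : ∀ i → Dec (Q i)) →
  count (λ i → P? i ×-dec Q? i) + count (λ i → P? i ×-dec ¬? (Q? i)) ≡ count P?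
count-split P? Q? =
  trans (sym (∑-distrib-+ (λ i → χ (P? i ×-dec Q? i)) (λ i → χ (P? i ×-dec ¬? (Q? i)))))
        (sum-cong-≗ (λ i → χ-split (P? i) (Q? i)))

count-∈-tail : ∀ {n} s (p : Subset n) → count (_∈? p) ≡ count (λ i → suc i ∈? s ∷ p)
count-∈-tail s p = sum-cong-≗ (λ i → χ-cong there drop-there (i ∈? p) (suc i ∈? s ∷ p))

card-count : ∀ {n} (p : Subset n) → ∣ p ∣ ≡ count (_∈? p)
card-count []            = refl
card-count (inside ∷ p)  = cong suc (trans (card-count p) (count-∈-tail inside p))
card-count (outside ∷ p) = trans (card-count p) (count-∈-tail outside p)

-- `sumOver` is a list sum of a summand local to Defs; this names that summand.
sumOver-summand : ∀ {n} (σ : Subset n) (f : Fin n → ℕ) →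
  Σ (Fin n → ℕ) λ g → sumOver σ f ≡ List.sum (map g (allFin n))
sumOver-summand σ f = _ , refl

summand-pointwise : ∀ {n} (σ : Subset n) (f : Fin n → ℕ) u →
  proj₁ (sumOver-summand σ f) u ≡ χ (u ∈? σ) * f u
summand-pointwise σ f u with u ∈? σ
... | yes _ = sym (+-identityʳ (f u))
... | no _  = refl

sumOver-∑ : ∀ {n} (σ : Subset n) (f : Fin n → ℕ) → sumOver σ f ≡ ∑[ v < n ] (χ (v ∈? σ) * f v)
sumOver-∑ σ f = trans (listSum-allFin (proj₁ (sumOver-summand σ f))) (sum-cong-≗ (summand-pointwise σ f))

x∈p─q⇒x∉q : ∀ {n} {x : Fin n} {p q : Subset n} → x ∈ p ─ q → x ∉ q
x∈p─q⇒x∉q {p = _ ∷ p} {outside ∷ q} here         = λ ()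
x∈p─q⇒x∉q {p = _ ∷ p} {_ ∷ q}       (there x∈p─q) = x∈p─q⇒x∉q x∈p─q ∘ drop-there

∈-∪⁅⁆⁻ : ∀ {n} {x y : Fin n} (p : Subset n) → x ∈ p ∪ ⁅ y ⁆ → x ∈ p ⊎ x ≡ y
∈-∪⁅⁆⁻ {y = y} p x∈ with x∈p∪q⁻ p ⁅ y ⁆ x∈
... | inj₁ x∈p = inj₁ x∈p
... | inj₂ x∈y = inj₂ (x∈⁅y⁆⇒x≡y y x∈y)

x∈p∪⁅x⁆ : ∀ {n} (p : Subset n) (x : Fin n) → x ∈ p ∪ ⁅ x ⁆
x∈p∪⁅x⁆ p x = x∈p∪q⁺ (inj₂ (x∈⁅x⁆ x))

∪⁅⁆-⊆ : ∀ {n} {p q : Subset n} {x} → p ⊆ q → x ∈ q → p ∪ ⁅ x ⁆ ⊆ q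
∪⁅⁆-⊆ {p = p} p⊆q x∈q y∈ with ∈-∪⁅⁆⁻ p y∈
... | inj₁ y∈p = p⊆q y∈p
... | inj₂ refl = x∈q

∣p∣<∣p∪⁅x⁆∣ : ∀ {n} {p : Subset n} {x} → x ∉ p → ∣ p ∣ < ∣ p ∪ ⁅ x ⁆ ∣
∣p∣<∣p∪⁅x⁆∣ {p = p} {x} x∉p = p⊂q⇒∣p∣<∣q∣ (p⊆p∪q ⁅ x ⁆ , x , x∈p∪⁅x⁆ p x , x∉p)

∣p-x∣+1 : ∀ {n} {x : Fin n} {p : Subset n} → x ∈ p → suc ∣ p - x ∣ ≡ ∣ p ∣
∣p-x∣+1 {x = zero}  {inside ∷ p}  here        = cong (suc ∘ ∣_∣) (p─⊥≡p p)
∣p-x∣+1 {x = suc x} {outside ∷ p} (there x∈p) = ∣p-x∣+1 x∈p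
∣p-x∣+1 {x = suc x} {inside ∷ p}  (there x∈p) = cong suc (∣p-x∣+1 x∈p)

nonempty-of-size : ∀ {n k} (p : Subset n) → ∣ p ∣ ≡ suc k → Nonempty p
nonempty-of-size p ∣p∣≡1+k = count-witness (_∈? p) (subst (1 ≤_) (trans (sym ∣p∣≡1+k) (card-count p)) (s≤s z≤n))

size1-unique : ∀ {n} (p : Subset n) → ∣ p ∣ ≡ 1 → ∀ {x y} → x ∈ p → y ∈ p → x ≡ y
size1-unique p ∣p∣≡1 = count-unique (_∈? p) (≤-reflexive (trans (sym (card-count p)) ∣p∣≡1))

size2⇒pair : ∀ {n} (K : Subset n) → ∣ K ∣ ≡ 2 →
  Σ (Fin n) λ a → Σ (Fin n) λ b → a ∈ K × b ∈ K × (∀ {x} → x ∈ K → x ≡ a ⊎ x ≡ b)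
size2⇒pair K ∣K∣≡2 with nonempty-of-size K ∣K∣≡2
... | a , a∈K = a , b , a∈K , p─q⊆p K ⁅ a ⁆ b∈K-a , a-or-b
  where
  ∣K-a∣≡1 : ∣ K - a ∣ ≡ 1
  ∣K-a∣≡1 = suc-injective (trans (∣p-x∣+1 a∈K) ∣K∣≡2)

  K-a-nonempty : Nonempty (K - a)
  K-a-nonempty = nonempty-of-size (K - a) ∣K-a∣≡1

  b : Fin _
  b = proj₁ K-a-nonempty

  b∈K-a : b ∈ K - a
  b∈K-a = proj₂ K-a-nonempty

  a-or-b : ∀ {x} → x ∈ K → x ≡ a ⊎ x ≡ b
  a-or-b {x} x∈K with x ≟ᶠ a
  ... | yes x≡a = inj₁ x≡a
  ... | no x≢a  = inj₂ (size1-unique (K - a) ∣K-a∣≡1 (x∈p∧x≢y⇒x∈p-y x∈K x≢a) b∈K-a)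

no-three-in-two : ∀ {A : Set} {r₁ r₂ x y z : A} →
  x ≡ r₁ ⊎ x ≡ r₂ → y ≡ r₁ ⊎ y ≡ r₂ → z ≡ r₁ ⊎ z ≡ r₂ → x ≢ y → x ≢ z → y ≢ z → ⊥
no-three-in-two (inj₁ refl) (inj₁ refl) _           x≢y _   _   = x≢y refl
no-three-in-two (inj₂ refl) (inj₂ refl) _           x≢y _   _   = x≢y refl
no-three-in-two (inj₁ refl) (inj₂ refl) (inj₁ refl) _   x≢z _   = x≢z refl
no-three-in-two (inj₁ refl) (inj₂ refl) (inj₂ refl) _   _   y≢z = y≢z refl
no-three-in-two (inj₂ refl) (inj₁ refl) (inj₁ refl) _   _   y≢z = y≢z refl
no-three-in-two (inj₂ refl) (inj₁ refl) (inj₂ refl) _   x≢z _   = x≢z refl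

module _ {n : ℕ} (Δ : SimplicialComplex n) where

  Adjacent : Fin n → Fin n → Set
  Adjacent a b = Σ (Subset n) λ ρ → Face Δ ρ × a ∈ ρ × b ∈ ρ

  Clique : Subset n → Set
  Clique K = ∀ {a b} → a ∈ K → b ∈ K → Adjacent a b

  pair-clique⇒face : ∀ {K} → Clique K → ∣ K ∣ ≡ 2 → Face Δ K
  pair-clique⇒face {K} K-clique ∣K∣≡2 with size2⇒pair K ∣K∣≡2
  ... | a , b , a∈K , b∈K , a-or-b with K-clique a∈K b∈K
  ...   | ρ , ρ-face , a∈ρ , b∈ρ = down-closed Δ ρ-face K⊆ρ
    where
    K⊆ρ : K ⊆ ρ
    K⊆ρ x∈K with a-or-b x∈K
    ... | inj₁ refl = a∈ρ
    ... | inj₂ refl = b∈ρ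

  -- In a flag complex every clique is a face (induction on its size: a
  -- non-face clique all of whose proper subsets are faces is a minimal
  -- non-face, hence an edge).
  clique⇒face : IsFlag Δ → ∀ {K} → Clique K → Face Δ K
  clique⇒face flag {K} = go (suc ∣ K ∣) ≤-refl
    where
    go : ∀ k {K} → ∣ K ∣ < k → Clique K → Face Δ K
    go (suc k) {K} ∣K∣<1+k K-clique with face? Δ K
    ... | yes K-face  = K-face
    ... | no K-nonface =
      contradiction (pair-clique⇒face K-clique (flag K (K-nonface , proper-faces))) K-nonface
      where
      proper-faces : ∀ τ → τ ⊂ K → Face Δ τ
      proper-faces τ τ⊂K = go k (<-≤-trans (p⊂q⇒∣p∣<∣q∣ τ⊂K) (s≤s⁻¹ ∣K∣<1+k))
                              (λ a∈τ b∈τ → K-clique (proj₁ τ⊂K a∈τ) (proj₁ τ⊂K b∈τ))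

  cone-clique : ∀ {ρ u} → Face Δ ρ → (∀ {a} → a ∈ ρ → Adjacent u a) → Clique (ρ ∪ ⁅ u ⁆)
  cone-clique {ρ} {u} ρ-face u-adj a∈ b∈ with ∈-∪⁅⁆⁻ ρ a∈ | ∈-∪⁅⁆⁻ ρ b∈
  ... | inj₁ a∈ρ | inj₁ b∈ρ = ρ , ρ-face , a∈ρ , b∈ρ
  ... | inj₂ refl | inj₁ b∈ρ = u-adj b∈ρ
  ... | inj₁ a∈ρ | inj₂ refl = let (τ , τ-face , u∈τ , a∈τ) = u-adj a∈ρ in τ , τ-face , a∈τ , u∈τ
  ... | inj₂ refl | inj₂ refl = ⁅ u ⁆ , vertex Δ u , x∈⁅x⁆ u , x∈⁅x⁆ u

  -- Every face lies in a facet: extend it greedily while possible.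
  face⊆facet : ∀ {A} → Face Δ A → Σ (Subset n) λ F → IsFacet Δ F × A ⊆ F
  face⊆facet {A} = extend (suc n) (m≤n+m (suc n) ∣ A ∣)
    where
    -- k bounds the number of extension steps still possible
    extend : ∀ k {A} → n < ∣ A ∣ + k → Face Δ A → Σ (Subset n) λ F → IsFacet Δ F × A ⊆ F
    extend k {A} room A-face with any? (λ x → ¬? (x ∈? A) ×-dec face? Δ (A ∪ ⁅ x ⁆))
    ... | no maximal = A , (A-face , only-A) , id
      where
      only-A : ∀ ρ → Face Δ ρ → A ⊆ ρ → ρ ≡ A
      only-A ρ ρ-face A⊆ρ = ⊆-antisym ρ⊆A A⊆ρ
        where
        ρ⊆A : ρ ⊆ A
        ρ⊆A {x} x∈ρ = decidable-stable (x ∈? A)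
          (λ x∉A → maximal (x , x∉A , down-closed Δ ρ-face (∪⁅⁆-⊆ A⊆ρ x∈ρ)))
    ... | yes (x , x∉A , A+x-face) with k
    ...   | zero  = contradiction (∣p∣≤n A) (<⇒≱ (subst (n <_) (+-identityʳ ∣ A ∣) room))
    ...   | suc k = let (F , F-facet , A+x⊆F) = extend k room′ A+x-face
                    in F , F-facet , A+x⊆F ∘ p⊆p∪q ⁅ x ⁆
      where
      room′ : n < ∣ A ∪ ⁅ x ⁆ ∣ + k
      room′ = <-≤-trans (subst (n <_) (+-suc ∣ A ∣ k) room) (+-monoˡ-≤ k (∣p∣<∣p∪⁅x⁆∣ x∉A))

  facet-maximal : ∀ {σ u} → IsFacet Δ σ → Face Δ (σ ∪ ⁅ u ⁆) → u ∈ σ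
  facet-maximal {σ} {u} (_ , maximal) σ+u-face =
    subst (u ∈_) (maximal (σ ∪ ⁅ u ⁆) σ+u-face (p⊆p∪q ⁅ u ⁆)) (x∈p∪⁅x⁆ σ u)

  link-vertex-adjacent : ∀ {v Wv u} → IsLinkVertexSet Δ ⁅ v ⁆ Wv → u ∈ Wv → u ≢ v × Adjacent u v
  link-vertex-adjacent {v} {Wv} {u} link u∈Wv with proj₁ (link u) u∈Wv
  ... | ρ , ρ-face , v⊆ρ , ⁅u⁆≡ρ-v =
    x∉⁅y⁆⇒x≢y (x∈p─q⇒x∉q u∈ρ-v) , ρ , ρ-face , p─q⊆p ρ ⁅ v ⁆ u∈ρ-v , v⊆ρ (x∈⁅x⁆ v)
    where
    u∈ρ-v : u ∈ ρ ─ ⁅ v ⁆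
    u∈ρ-v = subst (u ∈_) ⁅u⁆≡ρ-v (x∈⁅x⁆ u)

  -- In a weak 3-pseudomanifold, a ridge ρ of a facet σ has at most one apex
  -- outside σ: the facets through ρ ∪ {u₁}, ρ ∪ {u₂} and σ would be three
  -- distinct facets containing ρ.
  unique-apex : IsWeak3Pseudomanifold Δ → ∀ {σ ρ u₁ u₂} → IsFacet Δ σ → ρ ⊆ σ → ∣ ρ ∣ ≡ 3 →
    u₁ ∉ σ → u₂ ∉ σ → Face Δ (ρ ∪ ⁅ u₁ ⁆) → Face Δ (ρ ∪ ⁅ u₂ ⁆) → u₁ ≡ u₂
  unique-apex (pure , ridges) {σ} {ρ} {u₁} {u₂} σ-facet ρ⊆σ ∣ρ∣≡3 u₁∉σ u₂∉σ face₁ face₂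
    with u₁ ≟ᶠ u₂
  ... | yes u₁≡u₂ = u₁≡u₂
  ... | no u₁≢u₂
    with ridges ρ (down-closed Δ (proj₁ σ-facet) ρ⊆σ) ∣ρ∣≡3 | face⊆facet face₁ | face⊆facet face₂
  ... | (_ , _ , _ , _ , _ , _ , _ , on-ρ) | (F₁ , F₁-facet , ⊆F₁) | (F₂ , F₂-facet , ⊆F₂) =
    ⊥-elim (no-three-in-two (on-ρ σ σ-facet ρ⊆σ)
                            (on-ρ F₁ F₁-facet (⊆F₁ ∘ p⊆p∪q ⁅ u₁ ⁆))
                            (on-ρ F₂ F₂-facet (⊆F₂ ∘ p⊆p∪q ⁅ u₂ ⁆))
                            (λ σ≡F₁ → u₁∉σ (subst (u₁ ∈_) (sym σ≡F₁) (⊆F₁ (x∈p∪⁅x⁆ ρ u₁))))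
                            (λ σ≡F₂ → u₂∉σ (subst (u₂ ∈_) (sym σ≡F₂) (⊆F₂ (x∈p∪⁅x⁆ ρ u₂))))
                            F₁≢F₂)
    where
    u₂∉ρ+u₁ : u₂ ∉ ρ ∪ ⁅ u₁ ⁆
    u₂∉ρ+u₁ u₂∈ with ∈-∪⁅⁆⁻ ρ u₂∈
    ... | inj₁ u₂∈ρ  = u₂∉σ (ρ⊆σ u₂∈ρ)
    ... | inj₂ u₂≡u₁ = u₁≢u₂ (sym u₂≡u₁)

    -- ρ ∪ {u₁, u₂} has five vertices, too many for one facet
    F₁≢F₂ : F₁ ≢ F₂
    F₁≢F₂ F₁≡F₂ = <⇒≱ five≤ (≤-reflexive (pure F₁ F₁-facet))
      where
      open ≤-Reasoning
      five≤ : 4 < ∣ F₁ ∣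
      five≤ = begin-strict
        4                           ≡⟨ cong suc (sym ∣ρ∣≡3) ⟩
        suc ∣ ρ ∣                   ≤⟨ ∣p∣<∣p∪⁅x⁆∣ (u₁∉σ ∘ ρ⊆σ) ⟩
        ∣ ρ ∪ ⁅ u₁ ⁆ ∣              <⟨ ∣p∣<∣p∪⁅x⁆∣ u₂∉ρ+u₁ ⟩
        ∣ (ρ ∪ ⁅ u₁ ⁆) ∪ ⁅ u₂ ⁆ ∣   ≤⟨ p⊆q⇒∣p∣≤∣q∣ (∪⁅⁆-⊆ ⊆F₁ u₂∈F₁) ⟩
        ∣ F₁ ∣                      ∎
        where
        u₂∈F₁ : u₂ ∈ F₁
        u₂∈F₁ = subst (u₂ ∈_) (sym F₁≡F₂) (⊆F₂ (x∈p∪⁅x⁆ ρ u₂))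

module Counting {n : ℕ} (Δ : SimplicialComplex n) (flag : IsFlag Δ)
  (wpm : IsWeak3Pseudomanifold Δ) {σ : Subset n} (σ-facet : IsFacet Δ σ)
  (W : Fin n → Subset n) (links : ∀ v → IsLinkVertexSet Δ ⁅ v ⁆ (W v)) where

  ∣σ∣≡4 : ∣ σ ∣ ≡ 4
  ∣σ∣≡4 = proj₁ wpm σ σ-facet

  Hit Miss : Fin n → Fin n → Set
  Hit  u v = v ∈ σ × u ∈ W v
  Miss u v = v ∈ σ × u ∉ W v

  hit? : ∀ u v → Dec (Hit u v)
  hit? u v = v ∈? σ ×-dec u ∈? W v

  miss? : ∀ u v → Dec (Miss u v)
  miss? u v = v ∈? σ ×-dec ¬? (u ∈? W v)

  hits misses : Fin n → ℕ
  hits   u = count (hit? u)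
  misses u = count (miss? u)

  -- Σ_{v ∈ σ} f₀(lk v) counts the pairs (u, v) with u hitting v.
  double-count : sumOver σ (λ v → ∣ W v ∣) ≡ sum hits
  double-count = begin
    sumOver σ (λ v → ∣ W v ∣)                           ≡⟨ sumOver-∑ σ _ ⟩
    ∑[ v < n ] (χ (v ∈? σ) * ∣ W v ∣)                   ≡⟨ sum-cong-≗ (λ v → cong (χ (v ∈? σ) *_) (card-count (W v))) ⟩
    ∑[ v < n ] (χ (v ∈? σ) * ∑[ u < n ] χ (u ∈? W v))   ≡⟨ sum-cong-≗ (λ v → *-distribˡ-sum (χ (v ∈? σ)) (λ u → χ (u ∈? W v))) ⟩
    ∑[ v < n ] ∑[ u < n ] (χ (v ∈? σ) * χ (u ∈? W v))   ≡⟨ sum-cong-≗ (λ v → sum-cong-≗ (λ u → sym (χ-× (v ∈? σ) (u ∈? W v)))) ⟩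
    ∑[ v < n ] ∑[ u < n ] χ (hit? u v)                  ≡⟨ ∑-comm (λ v u → χ (hit? u v)) ⟩
    sum hits                                            ∎
    where open ≡-Reasoning

  hits+misses : ∀ u → hits u + misses u ≡ 4
  hits+misses u = trans (count-split (_∈? σ) (λ v → u ∈? W v)) (trans (sym (card-count σ)) ∣σ∣≡4)

  hits≤4∸ : ∀ {u k} → k ≤ misses u → hits u ≤ 4 ∸ k
  hits≤4∸ {u} {k} k≤misses = begin
    hits u                        ≡⟨ m+n∸n≡m (hits u) (misses u) ⟨
    hits u + misses u ∸ misses u  ≡⟨ cong (_∸ misses u) (hits+misses u) ⟩
    4 ∸ misses u                  ≤⟨ ∸-monoʳ-≤ 4 k≤misses ⟩
    4 ∸ k                         ∎
    where open ≤-Reasoning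

  cone-face : ∀ {ρ u} → ρ ⊆ σ → (∀ {v} → v ∈ ρ → ¬ Miss u v) → Face Δ (ρ ∪ ⁅ u ⁆)
  cone-face {ρ} {u} ρ⊆σ no-miss =
    clique⇒face Δ flag (cone-clique Δ (down-closed Δ (proj₁ σ-facet) ρ⊆σ) adjacent)
    where
    adjacent : ∀ {v} → v ∈ ρ → Adjacent Δ u v
    adjacent {v} v∈ρ = proj₂ (link-vertex-adjacent Δ (links v)
      (decidable-stable (u ∈? W v) (λ u∉Wv → no-miss v∈ρ (ρ⊆σ v∈ρ , u∉Wv))))

  misses≥1 : ∀ u → 1 ≤ misses u
  misses≥1 u with u ∈? σ
  ... | yes u∈σ = count-≥1 (miss? u) (u∈σ , λ u∈Wu → proj₁ (link-vertex-adjacent Δ (links u) u∈Wu) refl)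
  ... | no u∉σ  = ≮⇒≥ λ misses<1 →
    u∉σ (facet-maximal Δ σ-facet (cone-face id (λ _ miss → <⇒≱ misses<1 (count-≥1 (miss? u) miss))))

  Opposite : Fin n → Fin n → Set
  Opposite u v = u ∉ σ × Miss u v × misses u ≡ 1

  opposite? : ∀ u v → Dec (Opposite u v)
  opposite? u v = ¬? (u ∈? σ) ×-dec miss? u v ×-dec misses u ≟ 1

  opposites : Fin n → ℕ
  opposites u = count (opposite? u)

  hits-outside : ∀ {u} → u ∉ σ → Dec (misses u ≡ 1) → hits u ≤ 2 + opposites u
  hits-outside {u} u∉σ (yes misses≡1) =
    ≤-trans (hits≤4∸ (misses≥1 u)) (+-monoʳ-≤ 2 (count-≥1 (opposite? u) (u∉σ , miss , misses≡1)))
    where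
    miss = proj₂ (count-witness (miss? u) (≤-reflexive (sym misses≡1)))
  hits-outside {u} u∉σ (no misses≢1) =
    ≤-trans (hits≤4∸ (≤∧≢⇒< (misses≥1 u) (misses≢1 ∘ sym))) (m≤m+n 2 (opposites u))

  bound : Fin n → ℕ
  bound u = 2 + (χ (u ∈? σ) + opposites u)

  hits-bound : ∀ u → hits u ≤ bound u
  hits-bound u = by-membership (u ∈? σ)
    where
    by-membership : (u∈?σ : Dec (u ∈ σ)) → hits u ≤ 2 + (χ u∈?σ + opposites u)
    by-membership (yes _)  = ≤-trans (hits≤4∸ (misses≥1 u)) (m≤m+n 3 (opposites u))
    by-membership (no u∉σ) = hits-outside u∉σ (misses u ≟ 1)

  -- Each v ∈ σ has at most one opposite vertex: both would be apexes over
  -- the ridge σ − v.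
  opposite-unique : ∀ {v u₁ u₂} → Opposite u₁ v → Opposite u₂ v → u₁ ≡ u₂
  opposite-unique {v} opp₁@(u₁∉σ , (v∈σ , _) , _) opp₂@(u₂∉σ , _ , _) =
    unique-apex Δ wpm σ-facet (p─q⊆p σ ⁅ v ⁆) ∣σ-v∣≡3 u₁∉σ u₂∉σ (apex opp₁) (apex opp₂)
    where
    ∣σ-v∣≡3 : ∣ σ - v ∣ ≡ 3
    ∣σ-v∣≡3 = suc-injective (trans (∣p-x∣+1 v∈σ) ∣σ∣≡4)

    apex : ∀ {u} → Opposite u v → Face Δ ((σ - v) ∪ ⁅ u ⁆)
    apex {u} (_ , miss-v , misses≡1) = cone-face (p─q⊆p σ ⁅ v ⁆) λ {w} w∈σ-v miss-w →
      x∈p─q⇒x∉q w∈σ-v (subst (_∈ ⁅ v ⁆)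
        (sym (count-unique (miss? u) (≤-reflexive misses≡1) miss-w miss-v)) (x∈⁅x⁆ v))

  ∑opposites≤4 : sum opposites ≤ 4
  ∑opposites≤4 = begin
    ∑[ u < n ] ∑[ v < n ] χ (opposite? u v)  ≡⟨ ∑-comm (λ u v → χ (opposite? u v)) ⟩
    ∑[ v < n ] ∑[ u < n ] χ (opposite? u v)  ≤⟨ ∑-mono-≤ at-most-one ⟩
    count (_∈? σ)                            ≡⟨ card-count σ ⟨
    ∣ σ ∣                                    ≡⟨ ∣σ∣≡4 ⟩
    4                                        ∎
    where
    open ≤-Reasoning
    at-most-one : ∀ v → count (λ u → opposite? u v) ≤ χ (v ∈? σ)
    at-most-one v = count-≤-χ (λ u → opposite? u v) (proj₁ ∘ proj₁ ∘ proj₂) opposite-unique (v ∈? σ)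

  ∑bound≤ : sum bound ≤ 2 * n + 8
  ∑bound≤ = begin
    sum bound                                                 ≡⟨ ∑-distrib-+ (λ _ → 2) (λ u → χ (u ∈? σ) + opposites u) ⟩
    ∑[ u < n ] 2 + ∑[ u < n ] (χ (u ∈? σ) + opposites u)      ≡⟨ cong₂ _+_ (∑-const n 2) (∑-distrib-+ (λ u → χ (u ∈? σ)) opposites) ⟩
    n * 2 + (count (_∈? σ) + sum opposites)                   ≤⟨ +-monoʳ-≤ (n * 2) (+-mono-≤ ∣σ∣≤4 ∑opposites≤4) ⟩
    n * 2 + 8                                                 ≡⟨ cong (_+ 8) (*-comm n 2) ⟩
    2 * n + 8                                                 ∎
    where
    open ≤-Reasoning
    ∣σ∣≤4 : count (_∈? σ) ≤ 4
    ∣σ∣≤4 = ≤-reflexive (trans (sym (card-count σ)) ∣σ∣≡4)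

  link-size-bound : sumOver σ (λ v → ∣ W v ∣) ≤ 2 * n + 8
  link-size-bound = subst (_≤ 2 * n + 8) (sym double-count) (≤-trans (∑-mono-≤ hits-bound) ∑bound≤)

  -- At equality every pointwise bound is attained, so each vertex hits at least two vertices of σ.
  tight⇒hits≥2 : sumOver σ (λ v → ∣ W v ∣) ≡ 2 * n + 8 → ∀ u → 2 ≤ hits u
  tight⇒hits≥2 equality u = ≤-trans (m≤m+n 2 _)
    (∑-tight hits-bound (≤-trans ∑bound≤ (≤-reflexive (trans (sym equality) double-count))) u)

  ridge-links-cover : sumOver σ (λ v → ∣ W v ∣) ≡ 2 * n + 8 →
    ∀ τ → τ ⊆ σ → ∣ τ ∣ ≡ 3 → ∀ u → Σ (Fin n) λ w → w ∈ τ × u ∈ W w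
  ridge-links-cover equality τ τ⊆σ ∣τ∣≡3 u with any? (λ w → w ∈? τ ×-dec u ∈? W w)
  ... | yes covered = covered
  ... | no uncovered = ⊥-elim (<⇒≱ (s≤s (hits≤4∸ misses≥3)) (tight⇒hits≥2 equality u))
    where
    misses≥3 : 3 ≤ misses u
    misses≥3 = ≤-trans (≤-reflexive (trans (sym ∣τ∣≡3) (card-count τ)))
      (count-mono (_∈? τ) (miss? u) (λ {w} w∈τ → τ⊆σ w∈τ , λ u∈Ww → uncovered (w , w∈τ , u∈Ww)))

lemma5p3 : (n : ℕ) (Δ : SimplicialComplex n) →
    IsFlag Δ → IsWeak3Pseudomanifold Δ →
    (σ : Subset n) → IsFacet Δ σ →
    (W : Fin n → Subset n) → (∀ v → IsLinkVertexSet Δ ⁅ v ⁆ (W v)) →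
    (sumOver σ (λ v → ∣ W v ∣) ≤ 2 * n + 8)
    × (sumOver σ (λ v → ∣ W v ∣) ≡ 2 * n + 8 →
        ∀ τ → τ ⊆ σ → ∣ τ ∣ ≡ 3 →
          ∀ (u : Fin n) → Σ (Fin n) λ w → w ∈ τ × u ∈ W w)
lemma5p3 n Δ flag wpm σ σ-facet W links = link-size-bound , ridge-links-cover
  where open Counting Δ flag wpm σ-facet W links
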